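{- Let $q$ be a prime power, $n,k$ integers with $1<k<n-1$, $V=\mathbb{F}_q^n$, let $X,Y\in\mathcal{C}(n,k)_q$ be non-adjacent in the Grassmann graph $\Gamma_k(V)$, and let $m=\dim(X\cap Y)$. If $n<[k-m]_q\cdot(q+1)+m$, then there exists $Z\in\mathcal{C}(n,k)_q$ adjacent to $X$ in $\Gamma_k(V)$ such that $d(Z,Y)=d(X,Y)-1$.
   Context: $\mathbb{F}_q$ is the finite field with $q$ elements. For $i=1,\dots,n$, $C_i=\{(x_1,\dots,x_n)\in V: x_i=0\}$. A non-degenerate linear $[n,k]_q$ code is a $k$-dimensional subspace of $V$ not contained in any $C_i$; $\mathcal{C}(n,k)_q$ is the set of all such codes. The Grassmann graph $\Gamma_k(V)$ has as vertices the $k$-dimensional subspaces of $V$, two adjacent iff their intersection is $(k-1)$-dimensional; its graph distance is $d(X,Y)=k-\dim(X\cap Y)$. Notation: $[j]_q=\frac{q^j-1}{q-1}$. -}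

module Defs where

open import Level using (0ℓ)
open import Data.Nat using (ℕ; zero; suc; _∸_) renaming (_+_ to _+ℕ_; _*_ to _*ℕ_; _^_ to _^ℕ_)
open import Data.Fin using (Fin)
open import Data.Vec using (Vec; []; _∷_; lookup; replicate; zipWith; map; foldr)
open import Data.Product using (Σ; ∃; _×_; _,_)
open import Relation.Nullary using (¬_)
open import Relation.Binary.PropositionalEquality using (_≡_)
open import Function.Bundles using (_↔_)
open import Algebra.Core using (Op₁; Op₂)
open import Algebra.Structures using (IsCommutativeRing)

record FiniteField : Set₁ where
  field
    Carrier : Set
    _+_ : Op₂ Carrier
    _*_ : Op₂ Carrier
    -_  : Op₁ Carrier
    0#  : Carrier
    1#  : Carrier
    isCommutativeRing : IsCommutativeRing _≡_ _+_ _*_ -_ 0# 1#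
    0≢1 : ¬ (0# ≡ 1#)
    inverse : ∀ x → ¬ (x ≡ 0#) → ∃ λ y → (x * y) ≡ 1#
    size : ℕ
    enum : Carrier ↔ Fin size

-- Gaussian number [j]_q = (q^j - 1)/(q - 1) = 1 + q + ... + q^(j-1)
[_]_ : ℕ → ℕ → ℕ
[ zero ] q = 0
[ suc j ] q = (q ^ℕ j) +ℕ ([ j ] q)

module LinearAlgebra (F : FiniteField) where
  open FiniteField F

  Vect : ℕ → Set
  Vect n = Vec Carrier n

  zeroV : ∀ {n} → Vect n
  zeroV = replicate _ 0#

  _⊕_ : ∀ {n} → Vect n → Vect n → Vect n
  _⊕_ = zipWith _+_

  _·_ : ∀ {n} → Carrier → Vect n → Vect n
  c · v = map (c *_) v

  record Subspace (n : ℕ) : Set₁ where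
    field
      _∈S : Vect n → Set
      zero∈ : zeroV ∈S
      ⊕∈ : ∀ {x y} → x ∈S → y ∈S → (x ⊕ y) ∈S
      ·∈ : ∀ c {x} → x ∈S → (c · x) ∈S
  open Subspace public

  _∩_ : ∀ {n} → Subspace n → Subspace n → Subspace n
  X ∩ Y = record
    { _∈S = λ x → (_∈S X x) × (_∈S Y x)
    ; zero∈ = zero∈ X , zero∈ Y
    ; ⊕∈ = λ { (a , b) (c , d) → ⊕∈ X a c , ⊕∈ Y b d }
    ; ·∈ = λ { c (a , b) → ·∈ X c a , ·∈ Y c b }
    }

  lincomb : ∀ {n d} → Vec Carrier d → Vec (Vect n) d → Vect n
  lincomb [] [] = zeroV
  lincomb (c ∷ cs) (v ∷ vs) = (c · v) ⊕ lincomb cs vs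

  IsBasis : ∀ {n d} → Subspace n → Vec (Vect n) d → Set
  IsBasis {n} {d} S vs =
      (∀ (i : Fin d) → _∈S S (lookup vs i))
    × (∀ (cs : Vec Carrier d) → lincomb cs vs ≡ zeroV → cs ≡ replicate d 0#)
    × (∀ x → _∈S S x → ∃ λ (cs : Vec Carrier d) → x ≡ lincomb cs vs)

  HasDim : ∀ {n} → Subspace n → ℕ → Set
  HasDim {n} S d = ∃ λ (vs : Vec (Vect n) d) → IsBasis S vs

  Coord : ∀ {n} → Fin n → Subspace n
  Coord i = record
    { _∈S = λ x → lookup x i ≡ 0#
    ; zero∈ = zeroLemma
    ; ⊕∈ = λ {x} {y} p q → addLemma x y p q
    ; ·∈ = λ c {x} p → mulLemma c x p
    }
    where
      open IsCommutativeRing isCommutativeRing using (+-identityˡ; zeroʳ)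
      open import Relation.Binary.PropositionalEquality using (refl; trans; cong; cong₂)
      open import Data.Vec.Properties using (lookup-replicate; lookup-zipWith; lookup-map)
      zeroLemma : lookup zeroV i ≡ 0#
      zeroLemma = lookup-replicate i 0#
      addLemma : ∀ x y → lookup x i ≡ 0# → lookup y i ≡ 0# → lookup (x ⊕ y) i ≡ 0#
      addLemma x y p q = trans (lookup-zipWith _+_ i x y) (trans (cong₂ _+_ p q) (+-identityˡ 0#))
      mulLemma : ∀ c x → lookup x i ≡ 0# → lookup (c · x) i ≡ 0#
      mulLemma c x p = trans (lookup-map i (c *_) x) (trans (cong (c *_) p) (zeroʳ c))

  _⊆_ : ∀ {n} → Subspace n → Subspace n → Set
  X ⊆ Y = ∀ x → _∈S X x → _∈S Y x

  -- non-degenerate [n,k]_q code: a k-dim subspace not contained in any C_i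
  IsCode : (n k : ℕ) → Subspace n → Set
  IsCode n k X = HasDim X k × (∀ (i : Fin n) → ¬ (X ⊆ Coord i))

  -- adjacency in the Grassmann graph Γ_k(V) (X, Y both k-dimensional)
  Adjacent : ∀ {n} (k : ℕ) → Subspace n → Subspace n → Set
  Adjacent k X Y = HasDim (X ∩ Y) (k ∸ 1)

  -- graph distance d(X,Y) = k - dim(X ∩ Y)
  Distance : ∀ {n} (k : ℕ) → Subspace n → Subspace n → ℕ → Set
  Distance k X Y d = ∃ λ e → HasDim (X ∩ Y) e × d ≡ k ∸ e

module Submission where

-- Extend a basis B of X ∩ Y to bases U ++ B of X and W ++ B of Y, where |U| = |W| = k − m; then U ++ W ++ B is
-- independent. Call a coordinate special if all of B vanishes there. The remaining coordinates separate the
-- vectors of B, so there are at least m of them and hence fewer than (q + 1)[k − m]_q special ones; at each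
-- special coordinate i the columns g_i of U and f_i of W are nonzero vectors of F^(k−m). Pigeonhole over the
-- [k − m]_q points of PG(k − m − 1, q) gives a point p containing at most q of the g_i, and since q hyperplanes
-- cannot cover all q + 1 lifts of a vector, there is c with f_i · c ≠ 0 for those i. Then
--   Z = U(p^⊥) + ⟨W c⟩ + X ∩ Y
-- is non-degenerate, Z ∩ X = U(p^⊥) + X ∩ Y has dimension k − 1 and Z ∩ Y = ⟨W c⟩ + X ∩ Y has dimension
-- m + 1.

open import Defs
open import Level using (Level)
open import Data.Bool using (Bool; true; false; _∧_; not; if_then_else_)
open import Data.Nat using (ℕ; zero; suc; _+_; _*_; _^_; _∸_; _<_; _≤_; _≤?_; z≤n; s≤s)
import Data.Nat.Properties as ℕₚ
open import Data.Fin using (Fin; zero; suc)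
import Data.Fin.Properties as Finₚ
open import Data.Vec using (Vec; []; _∷_; lookup; replicate; map; _++_; head; tail; tabulate; splitAt)
open import Data.Vec.Properties
  using (zipWith-assoc; zipWith-comm; zipWith-identityˡ; zipWith-identityʳ; zipWith-inverseˡ; zipWith-inverseʳ;
         map-cong; map-∘; map-id; map-const; map-replicate; lookup-map; lookup-zipWith; lookup-replicate;
         tabulate∘lookup; tabulate-cong; lookup∘tabulate; tabulate-∘;
         ∷-injectiveˡ; ∷-injectiveʳ; ++-injective; map-++; ≡-dec)
open import Data.Product using (Σ; ∃; _×_; _,_; proj₁; proj₂)
open import Data.Product.Function.NonDependent.Propositional using (_×-↔_)
open import Data.Sum using (_⊎_; inj₁; inj₂)
import Data.Sum.Properties as ⊎ₚ
open import Data.Sum.Function.Propositional using (_⊎-↔_)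
open import Data.Unit using (⊤; tt)
import Data.Unit.Properties as ⊤ₚ
open import Function using (_∘_; _↔_; Inverse; Injection; mk↔ₛ′)
open import Function.Properties.Inverse using (↔-trans; ↔-sym; ↔⇒↣)
open import Relation.Nullary using (¬_; ¬?; Dec; does; yes; no; contradiction; map′)
open import Relation.Nullary.Decidable using (via-injection; decidable-stable)
open import Relation.Unary using (Pred; Decidable)
open import Relation.Unary.Properties using (_∩?_; ∁?; U?)
open import Relation.Binary using (DecidableEquality)
open import Relation.Binary.PropositionalEquality
  using (_≡_; refl; sym; trans; cong; cong₂; subst; subst₂; isEquivalence; module ≡-Reasoning)
open import Algebra.Bundles using (CommutativeRing; AbelianGroup)
open import Algebra.Structures using (IsCommutativeRing; IsAbelianGroup)
import Algebra.Properties.AbelianGroup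
import Algebra.Properties.CommutativeSemigroup
open import Algebra.Properties.CommutativeMonoid.Sum ℕₚ.+-0-commutativeMonoid
  using (sum; ∑-comm; ∑-distrib-+; sum-cong-≗; sum-replicate-zero)

private variable
  ℓ ℓ′ : Level
  n N t : ℕ
  A : Set

indicator : Bool → ℕ
indicator b = if b then 1 else 0

count : {P : Pred (Fin n) ℓ} → Decidable P → ℕ
count P? = sum (indicator ∘ does ∘ P?)

count-split : {P : Pred (Fin n) ℓ} {Q : Pred (Fin n) ℓ′} (P? : Decidable P) (Q? : Decidable Q) →
              count P? ≡ count (P? ∩? Q?) + count (P? ∩? ∁? Q?)
count-split P? Q? = trans (sum-cong-≗ λ i → split (does (P? i)) (does (Q? i)))
                          (∑-distrib-+ (indicator ∘ does ∘ (P? ∩? Q?)) (indicator ∘ does ∘ (P? ∩? ∁? Q?)))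
  where
  split : ∀ b c → indicator b ≡ indicator (b ∧ c) + indicator (b ∧ not c)
  split false _     = refl
  split true  true  = refl
  split true  false = refl

count-U : count {n = n} U? ≡ n
count-U {zero}  = refl
count-U {suc n} = cong suc (count-U {n})

count-complement : {P : Pred (Fin n) ℓ} (P? : Decidable P) → count P? + count (∁? P?) ≡ n
count-complement P? = trans (sym (count-split U? P?)) count-U

sum-mono-≤ : {f g : Fin n → ℕ} → (∀ i → f i ≤ g i) → sum f ≤ sum g
sum-mono-≤ {zero}  _   = z≤n
sum-mono-≤ {suc n} f≤g = ℕₚ.+-mono-≤ (f≤g zero) (sum-mono-≤ (f≤g ∘ suc))

count-mono : {P : Pred (Fin n) ℓ} {Q : Pred (Fin n) ℓ′} (P? : Decidable P) (Q? : Decidable Q) →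
             (∀ i → P i → Q i) → count P? ≤ count Q?
count-mono P? Q? P⊆Q = sum-mono-≤ λ i → pointwise i (P? i) (Q? i)
  where
  pointwise : ∀ i p? q? → indicator (does {A = _} p?) ≤ indicator (does q?)
  pointwise i (yes _)  (yes _) = ℕₚ.≤-refl
  pointwise i (yes Pi) (no ¬Qi) = contradiction (P⊆Q i Pi) ¬Qi
  pointwise i (no _)   _       = z≤n

count≤0⇒¬ : {P : Pred (Fin n) ℓ} (P? : Decidable P) → count P? ≤ 0 → ∀ i → ¬ P i
count≤0⇒¬ {n = suc n} P? c≤0 zero    Pi with P? zero
... | yes _  = contradiction c≤0 λ ()
... | no ¬Pi = ¬Pi Pi
count≤0⇒¬ {n = suc n} P? c≤0 (suc i) Pi with P? zero
... | no _ = count≤0⇒¬ (P? ∘ suc) c≤0 i Pi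

*≤sum : {f : Fin n → ℕ} (c : ℕ) → (∀ i → c ≤ f i) → n * c ≤ sum f
*≤sum {zero}  c c≤f = z≤n
*≤sum {suc n} c c≤f = ℕₚ.+-mono-≤ (c≤f zero) (*≤sum c (c≤f ∘ suc))

sum-delta : (x : Fin N) → sum (λ a → indicator (does (x Finₚ.≟ a))) ≡ 1
sum-delta {suc N} zero    = cong suc (sum-replicate-zero N)
sum-delta {suc N} (suc x) = sum-delta x

sum-fibres : {P : Pred (Fin n) ℓ} (P? : Decidable P) (f : Fin n → Fin N) →
             sum (λ a → count (P? ∩? λ i → f i Finₚ.≟ a)) ≡ count P?
sum-fibres {N = N} P? f =
  trans (∑-comm (λ a i → indicator (does (P? i) ∧ does (f i Finₚ.≟ a))))
        (sum-cong-≗ λ i → fibre (does (P? i)) (f i))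
  where
  fibre : ∀ b x → sum (λ a → indicator (b ∧ does (x Finₚ.≟ a))) ≡ indicator b
  fibre false x = sum-replicate-zero N
  fibre true  x = sum-delta x

pigeonhole-count : {P : Pred (Fin n) ℓ} (P? : Decidable P) (f : Fin n → Fin N) →
                   count P? < suc t * N → ∃ λ a → count (P? ∩? λ i → f i Finₚ.≟ a) ≤ t
pigeonhole-count {N = N} {t = t} P? f small
  with Finₚ.any? (λ a → count (P? ∩? λ i → f i Finₚ.≟ a) ≤? t)
... | yes fibre = fibre
... | no ¬fibre = contradiction small (ℕₚ.≤⇒≯ (begin
  suc t * N  ≡⟨ ℕₚ.*-comm (suc t) N ⟩
  N * suc t  ≤⟨ *≤sum (suc t) (λ a → ℕₚ.≰⇒> (λ c≤t → ¬fibre (a , c≤t))) ⟩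
  sum (λ a → count (P? ∩? λ i → f i Finₚ.≟ a)) ≡⟨ sum-fibres P? f ⟩
  count P?   ∎))
  where open ℕₚ.≤-Reasoning

module _ (_≟_ : DecidableEquality A) (A↔Fin : A ↔ Fin N) where
  open Inverse A↔Fin using (to; from; strictlyInverseˡ)

  pigeonhole-count-↔ : {P : Pred (Fin n) ℓ} (P? : Decidable P) (f : Fin n → A) →
                       count P? < suc t * N → ∃ λ a → count (P? ∩? λ i → f i ≟ a) ≤ t
  pigeonhole-count-↔ P? f small with pigeonhole-count P? (to ∘ f) small
  ... | j , fibre≤t = from j , ℕₚ.≤-trans
    (count-mono (P? ∩? λ i → f i ≟ from j) (P? ∩? λ i → to (f i) Finₚ.≟ j)
                λ i (Pi , fi≡) → Pi , trans (cong to fi≡) (strictlyInverseˡ j))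
    fibre≤t

  pigeonhole-miss : {P : Pred (Fin n) ℓ} (P? : Decidable P) (f : Fin n → A) →
                    count P? < N → ∃ λ a → ∀ i → P i → ¬ f i ≡ a
  pigeonhole-miss P? f small
    with pigeonhole-count-↔ {t = 0} P? f (subst (count P? <_) (sym (ℕₚ.+-identityʳ N)) small)
  ... | a , empty = a , λ i Pi fi≡a → count≤0⇒¬ (P? ∩? λ i → f i ≟ a) empty i (Pi , fi≡a)

select : {B : Set} {P : Pred (Fin n) ℓ} (P? : Decidable P) → Vec B n → Vec B (count P?)
select {n = zero}  P? []       = []
select {n = suc n} P? (x ∷ xs) with does (P? zero)
... | true  = x ∷ select (P? ∘ suc) xs
... | false = select (P? ∘ suc) xs

select-injective : {B : Set} {P : Pred (Fin n) ℓ} (P? : Decidable P) (xs ys : Vec B n) →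
                   (∀ i → ¬ P i → lookup xs i ≡ lookup ys i) → select P? xs ≡ select P? ys → xs ≡ ys
select-injective {n = zero}  P? []       []       _   _  = refl
select-injective {n = suc n} P? (x ∷ xs) (y ∷ ys) off eq with P? zero
... | yes _  = cong₂ _∷_ (∷-injectiveˡ eq) (select-injective (P? ∘ suc) xs ys (off ∘ suc) (∷-injectiveʳ eq))
... | no ¬P0 = cong₂ _∷_ (off zero ¬P0) (select-injective (P? ∘ suc) xs ys (off ∘ suc) eq)

∃? : {P : Pred A ℓ} → A ↔ Fin N → Decidable P → Dec (∃ P)
∃? {P = P} A↔Fin P? = map′ (λ (i , Pi) → from i , Pi) (λ (x , Px) → to x , subst P (sym (strictlyInverseʳ x)) Px)
                          (Finₚ.any? (P? ∘ from))
  where open Inverse A↔Fin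

m+n<o+p⇒p≤m⇒n<o : ∀ {m n o p} → m + n < o + p → p ≤ m → n < o
m+n<o+p⇒p≤m⇒n<o {m} {n} {o} {p} m+n<o+p p≤m = ℕₚ.+-cancelʳ-< p n o (begin-strict
  n + p  ≤⟨ ℕₚ.+-monoʳ-≤ n p≤m ⟩
  n + m  ≡⟨ ℕₚ.+-comm n m ⟩
  m + n  <⟨ m+n<o+p ⟩
  o + p  ∎)
  where open ℕₚ.≤-Reasoning

module _ (F : FiniteField) where
  open FiniteField F renaming (_+_ to infixl 6 _+F_; _*_ to infixl 7 _*F_; -_ to infix 8 -F_)
  open LinearAlgebra F renaming (_⊕_ to infixl 6 _⊕_; _·_ to infixr 7 _·_)
  open IsCommutativeRing isCommutativeRing
    using (+-assoc; +-comm; +-identityˡ; +-identityʳ; -‿inverseˡ; -‿inverseʳ;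
           *-assoc; *-comm; *-identityˡ; *-identityʳ; distribˡ; distribʳ; zeroˡ; zeroʳ)

  commutativeRing : CommutativeRing _ _
  commutativeRing = record { isCommutativeRing = isCommutativeRing }

  open import Algebra.Properties.Ring (CommutativeRing.ring commutativeRing)
    using (-1*x≈-x; -‿distribˡ-*; -‿distribʳ-*; +-inverseʳ-unique; -‿involutive)
  open import Algebra.Properties.CommutativeSemigroup (CommutativeRing.*-commutativeSemigroup commutativeRing)
    using (x∙yz≈y∙xz)

  private variable
    d e : ℕ

  infix 4 _≟F_
  _≟F_ : DecidableEquality Carrier
  _≟F_ = via-injection (↔⇒↣ enum) Finₚ._≟_

  _≟V_ : DecidableEquality (Vect n)
  _≟V_ = ≡-dec _≟F_

  1≢0 : ¬ 1# ≡ 0#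
  1≢0 = 0≢1 ∘ sym

  infix 9 _⁻¹
  _⁻¹ : Carrier → Carrier
  x ⁻¹ with x ≟F 0#
  ... | yes _   = 0#
  ... | no x≢0 = proj₁ (inverse x x≢0)

  ⁻¹-inverseʳ : ∀ x → ¬ x ≡ 0# → x *F x ⁻¹ ≡ 1#
  ⁻¹-inverseʳ x x≢0 with x ≟F 0#
  ... | yes x≡0 = contradiction x≡0 x≢0
  ... | no x≢0' = proj₂ (inverse x x≢0')

  ⁻¹-inverseˡ : ∀ x → ¬ x ≡ 0# → x ⁻¹ *F x ≡ 1#
  ⁻¹-inverseˡ x x≢0 = trans (*-comm (x ⁻¹) x) (⁻¹-inverseʳ x x≢0)

  infix 8 ⊖_
  ⊖_ : Vect n → Vect n
  ⊖_ = map -F_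

  ⊕-isAbelianGroup : IsAbelianGroup _≡_ (_⊕_ {n}) zeroV ⊖_
  ⊕-isAbelianGroup = record
    { isGroup = record
      { isMonoid = record
        { isSemigroup = record
          { isMagma = record { isEquivalence = isEquivalence ; ∙-cong = cong₂ _⊕_ }
          ; assoc   = zipWith-assoc +-assoc
          }
        ; identity = zipWith-identityˡ +-identityˡ , zipWith-identityʳ +-identityʳ
        }
      ; inverse = zipWith-inverseˡ -‿inverseˡ , zipWith-inverseʳ -‿inverseʳ
      ; ⁻¹-cong = cong ⊖_
      }
    ; comm = zipWith-comm +-comm
    }

  ⊕-abelianGroup : ℕ → AbelianGroup _ _
  ⊕-abelianGroup n = record { isAbelianGroup = ⊕-isAbelianGroup {n} }

  module ⊕ {n} = AbelianGroup (⊕-abelianGroup n)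
  module ⊕ₚ {n} = Algebra.Properties.AbelianGroup (⊕-abelianGroup n)
  module ⊕ₛ {n} = Algebra.Properties.CommutativeSemigroup (⊕.commutativeSemigroup {n})

  ·-distribˡ : ∀ c (u v : Vect n) → c · (u ⊕ v) ≡ c · u ⊕ c · v
  ·-distribˡ c []      []      = refl
  ·-distribˡ c (a ∷ u) (b ∷ v) = cong₂ _∷_ (distribˡ c a b) (·-distribˡ c u v)

  ·-distribʳ : ∀ a b (u : Vect n) → (a +F b) · u ≡ a · u ⊕ b · u
  ·-distribʳ a b []      = refl
  ·-distribʳ a b (x ∷ u) = cong₂ _∷_ (distribʳ x a b) (·-distribʳ a b u)

  ·-assoc : ∀ a b (u : Vect n) → (a *F b) · u ≡ a · (b · u)
  ·-assoc a b u = trans (map-cong (*-assoc a b) u) (map-∘ (a *F_) (b *F_) u)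

  ·-identityˡ : (u : Vect n) → 1# · u ≡ u
  ·-identityˡ u = trans (map-cong *-identityˡ u) (map-id u)

  ·-zeroˡ : (u : Vect n) → 0# · u ≡ zeroV
  ·-zeroˡ u = trans (map-cong zeroˡ u) (map-const u 0#)

  ·-zeroʳ : ∀ c → c · zeroV {n} ≡ zeroV
  ·-zeroʳ {n} c = trans (map-replicate (c *F_) 0# n) (cong (replicate n) (zeroʳ c))

  ⊖≗-1· : (u : Vect n) → ⊖ u ≡ (-F 1#) · u
  ⊖≗-1· u = sym (map-cong -1*x≈-x u)

  dot : Vect d → Vect d → Carrier
  dot []      []      = 0#
  dot (a ∷ u) (b ∷ v) = a *F b +F dot u v

  unit : Fin d → Vect d
  unit zero    = 1# ∷ zeroV
  unit (suc i) = 0# ∷ unit i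

  col : Fin n → Vec (Vect n) d → Vect d
  col i = map (λ v → lookup v i)

  dot-zeroʳ : (u : Vect d) → dot u zeroV ≡ 0#
  dot-zeroʳ []      = refl
  dot-zeroʳ (a ∷ u) = trans (cong₂ _+F_ (zeroʳ a) (dot-zeroʳ u)) (+-identityʳ 0#)

  dot-comm : (u v : Vect d) → dot u v ≡ dot v u
  dot-comm []      []      = refl
  dot-comm (a ∷ u) (b ∷ v) = cong₂ _+F_ (*-comm a b) (dot-comm u v)

  dot-·ʳ : ∀ c (u v : Vect d) → dot u (c · v) ≡ c *F dot u v
  dot-·ʳ c []      []      = sym (zeroʳ c)
  dot-·ʳ c (a ∷ u) (b ∷ v) = trans (cong₂ _+F_ (x∙yz≈y∙xz a c b) (dot-·ʳ c u v)) (sym (distribˡ c _ _))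

  dot-unitʳ : (u : Vect d) (j : Fin d) → dot u (unit j) ≡ lookup u j
  dot-unitʳ (a ∷ u) zero    = trans (cong₂ _+F_ (*-identityʳ a) (dot-zeroʳ u)) (+-identityʳ a)
  dot-unitʳ (a ∷ u) (suc j) = trans (cong₂ _+F_ (zeroʳ a) (dot-unitʳ u j)) (+-identityˡ _)

  lincomb-zeroˡ : (vs : Vec (Vect n) d) → lincomb zeroV vs ≡ zeroV
  lincomb-zeroˡ []       = refl
  lincomb-zeroˡ (v ∷ vs) = trans (cong₂ _⊕_ (·-zeroˡ v) (lincomb-zeroˡ vs)) (⊕.identityˡ zeroV)

  lincomb-⊕ : (cs ds : Vect d) (vs : Vec (Vect n) d) → lincomb (cs ⊕ ds) vs ≡ lincomb cs vs ⊕ lincomb ds vs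
  lincomb-⊕ []       []       []       = sym (⊕.identityˡ zeroV)
  lincomb-⊕ (c ∷ cs) (d ∷ ds) (v ∷ vs) =
    trans (cong₂ _⊕_ (·-distribʳ c d v) (lincomb-⊕ cs ds vs)) (⊕ₛ.interchange (c · v) (d · v) _ _)

  lincomb-· : ∀ a (cs : Vect d) (vs : Vec (Vect n) d) → lincomb (a · cs) vs ≡ a · lincomb cs vs
  lincomb-· a []       []       = sym (·-zeroʳ a)
  lincomb-· a (c ∷ cs) (v ∷ vs) =
    trans (cong₂ _⊕_ (·-assoc a c v) (lincomb-· a cs vs)) (sym (·-distribˡ a (c · v) _))

  lincomb-⊖ : (cs : Vect d) (vs : Vec (Vect n) d) → lincomb (⊖ cs) vs ≡ ⊖ lincomb cs vs
  lincomb-⊖ cs vs = begin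
    lincomb (⊖ cs) vs           ≡⟨ cong (λ ds → lincomb ds vs) (⊖≗-1· cs) ⟩
    lincomb ((-F 1#) · cs) vs   ≡⟨ lincomb-· (-F 1#) cs vs ⟩
    (-F 1#) · lincomb cs vs     ≡⟨ sym (⊖≗-1· _) ⟩
    ⊖ lincomb cs vs             ∎
    where open ≡-Reasoning

  lincomb-++ : (cs : Vect d) (ds : Vect e) (vs : Vec (Vect n) d) (ws : Vec (Vect n) e) →
               lincomb (cs ++ ds) (vs ++ ws) ≡ lincomb cs vs ⊕ lincomb ds ws
  lincomb-++ []       ds []       ws = sym (⊕.identityˡ _)
  lincomb-++ (c ∷ cs) ds (v ∷ vs) ws = trans (cong (c · v ⊕_) (lincomb-++ cs ds vs ws)) (sym (⊕.assoc _ _ _))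

  lincomb-zeroV++ : (cs : Vect e) (vs : Vec (Vect n) d) (ws : Vec (Vect n) e) →
                   lincomb (zeroV ++ cs) (vs ++ ws) ≡ lincomb cs ws
  lincomb-zeroV++ cs vs ws =
    trans (lincomb-++ zeroV cs vs ws) (trans (cong (_⊕ lincomb cs ws) (lincomb-zeroˡ vs)) (⊕.identityˡ _))

  lincomb-++zeroV : (cs : Vect d) (vs : Vec (Vect n) d) (ws : Vec (Vect n) e) →
                   lincomb (cs ++ zeroV) (vs ++ ws) ≡ lincomb cs vs
  lincomb-++zeroV cs vs ws =
    trans (lincomb-++ cs zeroV vs ws) (trans (cong (lincomb cs vs ⊕_) (lincomb-zeroˡ ws)) (⊕.identityʳ _))

  lincomb-lincomb : (α : Vect e) (K : Vec (Vect d) e) (U : Vec (Vect n) d) →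
                    lincomb α (map (λ k → lincomb k U) K) ≡ lincomb (lincomb α K) U
  lincomb-lincomb []      []      U = sym (lincomb-zeroˡ U)
  lincomb-lincomb (a ∷ α) (k ∷ K) U =
    trans (cong₂ _⊕_ (sym (lincomb-· a k U)) (lincomb-lincomb α K U)) (sym (lincomb-⊕ (a · k) _ U))

  lincomb-unit : (i : Fin d) (vs : Vec (Vect n) d) → lincomb (unit i) vs ≡ lookup vs i
  lincomb-unit zero    (v ∷ vs) = trans (cong₂ _⊕_ (·-identityˡ v) (lincomb-zeroˡ vs)) (⊕.identityʳ v)
  lincomb-unit (suc i) (v ∷ vs) = trans (cong₂ _⊕_ (·-zeroˡ v) (lincomb-unit i vs)) (⊕.identityˡ _)

  lookup-lincomb : (i : Fin n) (cs : Vect d) (vs : Vec (Vect n) d) → lookup (lincomb cs vs) i ≡ dot cs (col i vs)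
  lookup-lincomb i []       []       = lookup-replicate i 0#
  lookup-lincomb i (c ∷ cs) (v ∷ vs) =
    trans (lookup-zipWith _+F_ i (c · v) (lincomb cs vs)) (cong₂ _+F_ (lookup-map i (c *F_) v) (lookup-lincomb i cs vs))

  q : ℕ
  q = size

  1<q : 1 < q
  1<q = Finₚ.injective⇒≤ {f = f} f-injective
    where
    open Injection (↔⇒↣ enum) using (to; injective)
    f : Fin 2 → Fin q
    f zero    = to 0#
    f (suc _) = to 1#
    f-injective : ∀ {i j} → f i ≡ f j → i ≡ j
    f-injective {zero}     {zero}     _ = refl
    f-injective {zero}     {suc zero} e = contradiction (injective e) 0≢1
    f-injective {suc zero} {zero}     e = contradiction (injective e) 1≢0
    f-injective {suc zero} {suc zero} _ = refl

  Vect↔Fin : ∀ d → Vect d ↔ Fin (q ^ d)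
  Vect↔Fin zero    = mk↔ₛ′ (λ _ → zero) (λ _ → []) (λ { zero → refl }) (λ { [] → refl })
  Vect↔Fin (suc d) = ↔-trans ∷↔× (↔-trans (enum ×-↔ Vect↔Fin d) (↔-sym Finₚ.*↔×))
    where
    ∷↔× : Vect (suc d) ↔ (Carrier × Vect d)
    ∷↔× = mk↔ₛ′ (λ v → head v , tail v) (λ (a , v) → a ∷ v) (λ _ → refl) (λ { (a ∷ v) → refl })

  injective⇒≤ : ∀ {a b} (f : Vect a → Vect b) → (∀ x y → f x ≡ f y → x ≡ y) → a ≤ b
  injective⇒≤ {a} {b} f f-injective = ℕₚ.≮⇒≥ λ b<a → ℕₚ.<⇒≱ (ℕₚ.^-monoʳ-< q 1<q b<a) q^a≤q^b
    where
    open Inverse (Vect↔Fin a) using () renaming (to to toᵃ; from to fromᵃ; strictlyInverseˡ to invᵃ)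
    open Injection (↔⇒↣ (Vect↔Fin b)) using () renaming (to to toᵇ; injective to toᵇ-injective)
    q^a≤q^b : q ^ a ≤ q ^ b
    q^a≤q^b = Finₚ.injective⇒≤ {f = toᵇ ∘ f ∘ fromᵃ}
      λ {i} {j} e → trans (sym (invᵃ i)) (trans (cong toᵃ (f-injective _ _ (toᵇ-injective e))) (invᵃ j))

  infix 4 _∈_
  _∈_ : Vect n → Subspace n → Set
  x ∈ S = _∈S S x

  InSpan : Vec (Vect n) d → Vect n → Set
  InSpan vs x = ∃ λ cs → x ≡ lincomb cs vs

  InSpan? : (vs : Vec (Vect n) d) → ∀ x → Dec (InSpan vs x)
  InSpan? {d = d} vs x = ∃? (Vect↔Fin d) (λ cs → x ≟V lincomb cs vs)

  span : Vec (Vect n) d → Subspace n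
  span vs = record
    { _∈S   = InSpan vs
    ; zero∈ = zeroV , sym (lincomb-zeroˡ vs)
    ; ⊕∈    = λ (cs , x≡) (ds , y≡) → cs ⊕ ds , trans (cong₂ _⊕_ x≡ y≡) (sym (lincomb-⊕ cs ds vs))
    ; ·∈    = λ c (cs , x≡) → c · cs , trans (cong (c ·_) x≡) (sym (lincomb-· c cs vs))
    }

  lincomb-∈ : (S : Subspace n) {vs : Vec (Vect n) d} → (∀ i → lookup vs i ∈ S) → ∀ cs → lincomb cs vs ∈ S
  lincomb-∈ S {[]}     vs∈S []       = zero∈ S
  lincomb-∈ S {v ∷ vs} vs∈S (c ∷ cs) = ⊕∈ S (·∈ S c (vs∈S zero)) (lincomb-∈ S (vs∈S ∘ suc) cs)

  Independent : Vec (Vect n) d → Set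
  Independent vs = ∀ cs → lincomb cs vs ≡ zeroV → cs ≡ zeroV

  lincomb-injective : {vs : Vec (Vect n) d} → Independent vs → ∀ cs ds → lincomb cs vs ≡ lincomb ds vs → cs ≡ ds
  lincomb-injective {vs = vs} independent cs ds eq = ⊕ₚ.x∙y⁻¹≈ε⇒x≈y cs ds (independent (cs ⊕ ⊖ ds) (begin
    lincomb (cs ⊕ ⊖ ds) vs             ≡⟨ lincomb-⊕ cs (⊖ ds) vs ⟩
    lincomb cs vs ⊕ lincomb (⊖ ds) vs  ≡⟨ cong₂ _⊕_ eq (lincomb-⊖ ds vs) ⟩
    lincomb ds vs ⊕ ⊖ lincomb ds vs    ≡⟨ ⊕.inverseʳ _ ⟩
    zeroV                              ∎))
    where open ≡-Reasoning

  span-isBasis : {vs : Vec (Vect n) d} → Independent vs → IsBasis (span vs) vs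
  span-isBasis {vs = vs} independent = (λ i → unit i , sym (lincomb-unit i vs)) , independent , λ _ x∈ → x∈

  c·u≡w⇒u≡c⁻¹·w : ∀ c (u w : Vect n) → ¬ c ≡ 0# → c · u ≡ w → u ≡ c ⁻¹ · w
  c·u≡w⇒u≡c⁻¹·w c u w c≢0 c·u≡w = begin
    u                  ≡⟨ sym (·-identityˡ u) ⟩
    1# · u             ≡⟨ cong (_· u) (sym (⁻¹-inverseˡ c c≢0)) ⟩
    (c ⁻¹ *F c) · u    ≡⟨ ·-assoc (c ⁻¹) c u ⟩
    c ⁻¹ · (c · u)     ≡⟨ cong (c ⁻¹ ·_) c·u≡w ⟩
    c ⁻¹ · w           ∎
    where open ≡-Reasoning

  Independent-∷ : {v : Vect n} {vs : Vec (Vect n) d} → Independent vs → ¬ InSpan vs v → Independent (v ∷ vs)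
  Independent-∷ {v = v} {vs} independent v∉ (c ∷ cs) eq with c ≟F 0#
  ... | yes refl =
    cong (0# ∷_) (independent cs (trans (sym (⊕.identityˡ _)) (trans (cong (_⊕ lincomb cs vs) (sym (·-zeroˡ v))) eq)))
  ... | no c≢0   = contradiction (c ⁻¹ · ⊖ cs , v≡) v∉
    where
    v≡ : v ≡ lincomb (c ⁻¹ · ⊖ cs) vs
    v≡ = begin
      v                          ≡⟨ c·u≡w⇒u≡c⁻¹·w c v _ c≢0 (⊕ₚ.inverseˡ-unique _ _ eq) ⟩
      c ⁻¹ · ⊖ lincomb cs vs     ≡⟨ cong (c ⁻¹ ·_) (sym (lincomb-⊖ cs vs)) ⟩
      c ⁻¹ · lincomb (⊖ cs) vs   ≡⟨ sym (lincomb-· (c ⁻¹) (⊖ cs) vs) ⟩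
      lincomb (c ⁻¹ · ⊖ cs) vs   ∎
      where open ≡-Reasoning

  InSpan-∷ : {v x : Vect n} {vs : Vec (Vect n) d} → InSpan vs x → InSpan (v ∷ vs) x
  InSpan-∷ {v = v} {vs = vs} (cs , x≡) =
    0# ∷ cs , trans x≡ (sym (trans (cong (_⊕ lincomb cs vs) (·-zeroˡ v)) (⊕.identityˡ _)))

  extend-independent : ∀ {k p} (S : Subspace n) (bs : Vec (Vect n) k) {M : Vec (Vect n) p} →
    (∀ j → lookup bs j ∈ S) → (∀ i → lookup M i ∈ S) → Independent M →
    Σ ℕ λ L → Σ (Vec (Vect n) L) λ U →
      (∀ i → lookup (U ++ M) i ∈ S) × Independent (U ++ M) × (∀ j → InSpan (U ++ M) (lookup bs j))
  extend-independent S []       bs∈S M∈S independent = 0 , [] , M∈S , independent , λ ()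
  extend-independent S (b ∷ bs) {M} bs∈S M∈S independent
    with extend-independent S bs (bs∈S ∘ suc) M∈S independent
  ... | L , U , U∈S , independentU , spans with InSpan? (U ++ M) b
  ...   | yes b∈ = L , U , U∈S , independentU , λ { zero → b∈ ; (suc j) → spans j }
  ...   | no b∉  = suc L , b ∷ U , (λ { zero → bs∈S zero ; (suc i) → U∈S i }) , Independent-∷ independentU b∉ ,
                   λ { zero → unit zero , sym (lincomb-unit zero (b ∷ U ++ M)) ; (suc j) → InSpan-∷ (spans j) }

  extend-basis : ∀ {k p} (S : Subspace n) {bs : Vec (Vect n) k} → IsBasis S bs →
    {M : Vec (Vect n) p} → (∀ i → lookup M i ∈ S) → Independent M →
    Σ ℕ λ L → Σ (Vec (Vect n) L) λ U → IsBasis S (U ++ M)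
  extend-basis S {bs} (bs∈S , _ , bs-spans) {M} M∈S independent
    with extend-independent S bs bs∈S M∈S independent
  ... | L , U , U∈S , independentU , spans = L , U , U∈S , independentU , λ x x∈S →
    let cs , x≡ = bs-spans x x∈S in
    subst (InSpan (U ++ M)) (sym x≡) (lincomb-∈ (span (U ++ M)) spans cs)

  dim-≤ : ∀ {a b} (S : Subspace n) → HasDim S a → HasDim S b → a ≤ b
  dim-≤ {a = a} {b} S (us , us∈S , independent , _) (vs , _ , _ , vs-spans) = injective⇒≤ coords coords-injective
    where
    coords : Vect a → Vect b
    coords cs = proj₁ (vs-spans (lincomb cs us) (lincomb-∈ S us∈S cs))
    coords-injective : ∀ cs ds → coords cs ≡ coords ds → cs ≡ ds
    coords-injective cs ds eq = lincomb-injective independent cs ds (begin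
      lincomb cs us             ≡⟨ proj₂ (vs-spans (lincomb cs us) (lincomb-∈ S us∈S cs)) ⟩
      lincomb (coords cs) vs    ≡⟨ cong (λ es → lincomb es vs) eq ⟩
      lincomb (coords ds) vs    ≡⟨ sym (proj₂ (vs-spans (lincomb ds us) (lincomb-∈ S us∈S ds))) ⟩
      lincomb ds us             ∎)
      where open ≡-Reasoning

  dim-unique : ∀ {a b} (S : Subspace n) → HasDim S a → HasDim S b → a ≡ b
  dim-unique S dimₐ dimᵦ = ℕₚ.≤-antisym (dim-≤ S dimₐ dimᵦ) (dim-≤ S dimᵦ dimₐ)

  -- Points of PG(d, q) in reduced echelon form: pivot v is ⟨(1, v)⟩ and shift p is ⟨(0, p)⟩.
  -- hyperplane p is a basis of the hyperplane orthogonal to p, so g ∈⟨ p ⟩ says that g lies on the line p.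
  data Point : ℕ → Set where
    pivot : Vect d → Point (suc d)
    shift : Point (suc d) → Point (suc (suc d))

  hyperplane : Point (suc d) → Vec (Vect (suc d)) d
  hyperplane (pivot v) = tabulate (λ j → -F lookup v j ∷ unit j)
  hyperplane (shift p) = unit zero ∷ map (0# ∷_) (hyperplane p)

  infix 4 _∈⟨_⟩ _∈⟨_⟩?
  _∈⟨_⟩ : Vect (suc d) → Point (suc d) → Set
  g ∈⟨ p ⟩ = ∀ j → dot g (lookup (hyperplane p) j) ≡ 0#

  _∈⟨_⟩? : (g : Vect (suc d)) (p : Point (suc d)) → Dec (g ∈⟨ p ⟩)
  g ∈⟨ p ⟩? = Finₚ.all? λ j → dot g (lookup (hyperplane p) j) ≟F 0#

  ≗⇒≡ : {u v : Vect d} → (∀ j → lookup u j ≡ lookup v j) → u ≡ v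
  ≗⇒≡ {u = u} {v} u≗v = trans (sym (tabulate∘lookup u)) (trans (tabulate-cong u≗v) (tabulate∘lookup v))

  ∈⟨pivot⟩⇒≡ : ∀ a (g v : Vect d) → a ∷ g ∈⟨ pivot v ⟩ → g ≡ a · v
  ∈⟨pivot⟩⇒≡ a g v g∈ = ≗⇒≡ λ j → begin
    lookup g j                 ≡⟨ +-inverseʳ-unique (-F (a *F lookup v j)) (lookup g j) (g∈′ j) ⟩
    -F -F (a *F lookup v j)    ≡⟨ -‿involutive _ ⟩
    a *F lookup v j            ≡⟨ sym (lookup-map j (a *F_) v) ⟩
    lookup (a · v) j           ∎
    where
    open ≡-Reasoning
    g∈′ : ∀ j → -F (a *F lookup v j) +F lookup g j ≡ 0#
    g∈′ j = begin
      -F (a *F lookup v j) +F lookup g j             ≡⟨ cong₂ _+F_ (-‿distribʳ-* a _) (sym (dot-unitʳ g j)) ⟩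
      dot (a ∷ g) (-F lookup v j ∷ unit j)           ≡⟨ cong (dot (a ∷ g)) (sym (lookup∘tabulate _ j)) ⟩
      dot (a ∷ g) (lookup (hyperplane (pivot v)) j)  ≡⟨ g∈ j ⟩
      0#                                             ∎

  ∈⟨pivot⟩⇒normalised : (g : Vect (suc d)) (v : Vect d) → g ∈⟨ pivot v ⟩ → ¬ g ≡ zeroV →
                         ¬ head g ≡ 0# × head g ⁻¹ · tail g ≡ v
  ∈⟨pivot⟩⇒normalised (a ∷ g) v g∈ nonzero = a≢0 , (begin
    a ⁻¹ · g          ≡⟨ cong (a ⁻¹ ·_) (∈⟨pivot⟩⇒≡ a g v g∈) ⟩
    a ⁻¹ · (a · v)    ≡⟨ sym (·-assoc (a ⁻¹) a v) ⟩
    (a ⁻¹ *F a) · v   ≡⟨ cong (_· v) (⁻¹-inverseˡ a a≢0) ⟩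
    1# · v            ≡⟨ ·-identityˡ v ⟩
    v                 ∎)
    where
    open ≡-Reasoning
    a≢0 : ¬ a ≡ 0#
    a≢0 refl = nonzero (cong (0# ∷_) (trans (∈⟨pivot⟩⇒≡ 0# g v g∈) (·-zeroˡ v)))

  ∈⟨shift⟩⇒ : (g : Vect (suc (suc d))) (p : Point (suc d)) → g ∈⟨ shift p ⟩ → head g ≡ 0# × tail g ∈⟨ p ⟩
  ∈⟨shift⟩⇒ (a ∷ g) p g∈ = trans (sym (dot-unitʳ (a ∷ g) zero)) (g∈ zero) , λ j → begin
    dot g (lookup (hyperplane p) j)
      ≡⟨ sym (+-identityˡ _) ⟩
    0# +F dot g (lookup (hyperplane p) j)
      ≡⟨ cong (_+F dot g (lookup (hyperplane p) j)) (sym (zeroʳ a)) ⟩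
    dot (a ∷ g) (0# ∷ lookup (hyperplane p) j)
      ≡⟨ cong (dot (a ∷ g)) (sym (lookup-map j (0# ∷_) (hyperplane p))) ⟩
    dot (a ∷ g) (lookup (hyperplane (shift p)) (suc j))
      ≡⟨ g∈ (suc j) ⟩
    0#                                                     ∎
    where open ≡-Reasoning

  lincomb-0∷ : (α : Vect e) (vs : Vec (Vect n) e) → lincomb α (map (0# ∷_) vs) ≡ 0# ∷ lincomb α vs
  lincomb-0∷ []      []       = refl
  lincomb-0∷ (a ∷ α) (v ∷ vs) =
    trans (cong (a · (0# ∷ v) ⊕_) (lincomb-0∷ α vs))
          (cong (_∷ a · v ⊕ lincomb α vs) (trans (+-identityʳ _) (zeroʳ a)))

  a·e₀⊕0∷w≡a∷w : ∀ a (w : Vect d) → a · unit zero ⊕ (0# ∷ w) ≡ a ∷ w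
  a·e₀⊕0∷w≡a∷w a w =
    cong₂ _∷_ (trans (+-identityʳ _) (*-identityʳ a)) (trans (cong (_⊕ w) (·-zeroʳ a)) (⊕.identityˡ w))

  lincomb-units : (α : Vect d) → lincomb α (tabulate unit) ≡ α
  lincomb-units []      = refl
  lincomb-units (a ∷ α) = begin
    a · unit zero ⊕ lincomb α (tabulate (λ j → 0# ∷ unit j))
      ≡⟨ cong (λ vs → a · unit zero ⊕ lincomb α vs) (tabulate-∘ (0# ∷_) unit) ⟩
    a · unit zero ⊕ lincomb α (map (0# ∷_) (tabulate unit))
      ≡⟨ cong (a · unit zero ⊕_) (lincomb-0∷ α _) ⟩
    a · unit zero ⊕ (0# ∷ lincomb α (tabulate unit))
      ≡⟨ a·e₀⊕0∷w≡a∷w a _ ⟩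
    a ∷ lincomb α (tabulate unit)
      ≡⟨ cong (a ∷_) (lincomb-units α) ⟩
    a ∷ α                                                      ∎
    where open ≡-Reasoning

  tail-lincomb : (α : Vect e) (vs : Vec (Vect (suc n)) e) → tail (lincomb α vs) ≡ lincomb α (map tail vs)
  tail-lincomb []      []             = refl
  tail-lincomb (a ∷ α) ((x ∷ v) ∷ vs) with lincomb α vs | tail-lincomb α vs
  ... | y ∷ w | w≡ = cong (a · v ⊕_) w≡

  hyperplane-independent : (p : Point (suc d)) → Independent (hyperplane p)
  hyperplane-independent (pivot v) α eq = begin
    α                                             ≡⟨ sym (lincomb-units α) ⟩
    lincomb α (tabulate unit)                     ≡⟨ cong (lincomb α) (tabulate-∘ tail (λ j → -F lookup v j ∷ unit j)) ⟩
    lincomb α (map tail (hyperplane (pivot v)))   ≡⟨ sym (tail-lincomb α _) ⟩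
    tail (lincomb α (hyperplane (pivot v)))       ≡⟨ cong tail eq ⟩
    zeroV                                         ∎
    where open ≡-Reasoning
  hyperplane-independent (shift p) (a ∷ α) eq =
    cong₂ _∷_ (∷-injectiveˡ a∷≡0) (hyperplane-independent p α (∷-injectiveʳ a∷≡0))
    where
    a∷≡0 : a ∷ lincomb α (hyperplane p) ≡ zeroV
    a∷≡0 = trans (sym (trans (cong (a · unit zero ⊕_) (lincomb-0∷ α (hyperplane p))) (a·e₀⊕0∷w≡a∷w a _))) eq

  tail-nonzero : (g : Vect (suc d)) → head g ≡ 0# → ¬ g ≡ zeroV → ¬ tail g ≡ zeroV
  tail-nonzero (a ∷ g) refl nonzero g≡0 = nonzero (cong (0# ∷_) g≡0)

  -- Either few vectors have first coordinate 0 and a point (0 : p) is found recursively, or many do not,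
  -- and by pigeonhole over the q ^ d points (1 : v) one of these lies on at most q of them.
  few-on-some-point : ∀ d {N} {P : Pred (Fin N) ℓ} (P? : Decidable P) (g : Fin N → Vect (suc d)) →
    (∀ i → P i → ¬ g i ≡ zeroV) → count P? < suc q * [ suc d ] q →
    ∃ λ (p : Point (suc d)) → count (P? ∩? λ i → g i ∈⟨ p ⟩?) ≤ q
  few-on-some-point zero P? g _ small =
    pivot [] , ℕₚ.≤-trans (count-mono (P? ∩? λ i → g i ∈⟨ pivot [] ⟩?) P? (λ _ → proj₁))
                          (ℕₚ.≤-pred (subst (count P? <_) (ℕₚ.*-identityʳ (suc q)) small))
  few-on-some-point (suc d) P? g nonzero small = by-cases (count (P? ∩? Z?) ℕₚ.<? suc q * [ suc d ] q)
    where
    Z? : Decidable (λ i → head (g i) ≡ 0#)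
    Z? i = head (g i) ≟F 0#

    normalised : Fin _ → Vect (suc d)
    normalised i = head (g i) ⁻¹ · tail (g i)

    by-cases : Dec (count (P? ∩? Z?) < suc q * [ suc d ] q) → ∃ λ p → count (P? ∩? λ i → g i ∈⟨ p ⟩?) ≤ q
    by-cases (yes few-zero) =
      let p , few = few-on-some-point d (P? ∩? Z?) (tail ∘ g) (λ i (Pi , zi) → tail-nonzero (g i) zi (nonzero i Pi)) few-zero
      in shift p , ℕₚ.≤-trans
           (count-mono (P? ∩? λ i → g i ∈⟨ shift p ⟩?) ((P? ∩? Z?) ∩? λ i → tail (g i) ∈⟨ p ⟩?)
                       λ i (Pi , g∈) → let zi , t∈ = ∈⟨shift⟩⇒ (g i) p g∈ in (Pi , zi) , t∈)
           few
    by-cases (no many-zero) =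
      let v , few = pigeonhole-count-↔ _≟V_ (Vect↔Fin (suc d)) (P? ∩? ∁? Z?) normalised few-nonzero
      in pivot v , ℕₚ.≤-trans
           (count-mono (P? ∩? λ i → g i ∈⟨ pivot v ⟩?) ((P? ∩? ∁? Z?) ∩? λ i → normalised i ≟V v)
                       λ i (Pi , g∈) → let z̸i , n≡ = ∈⟨pivot⟩⇒normalised (g i) v g∈ (nonzero i Pi)
                                       in (Pi , z̸i) , n≡)
           few
      where
      few-nonzero : count (P? ∩? ∁? Z?) < suc q * q ^ suc d
      few-nonzero = m+n<o+p⇒p≤m⇒n<o
        (subst₂ _<_ (count-split P? Z?) (ℕₚ.*-distribˡ-+ (suc q) (q ^ suc d) ([ suc d ] q)) small)
        (ℕₚ.≮⇒≥ many-zero)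

  ⊤⊎Carrier↔Fin : (⊤ ⊎ Carrier) ↔ Fin (suc q)
  ⊤⊎Carrier↔Fin = ↔-sym (↔-trans Finₚ.+↔⊎ (Finₚ.1↔⊤ ⊎-↔ ↔-sym enum))

  -- The q + 1 lifts of c′. A nonzero g whose tail is zero or not orthogonal to c′ is orthogonal to at most one
  -- of them, namely lift (killed g).
  module Lifts (c′ : Vect d) where

    lift : ⊤ ⊎ Carrier → Vect (suc d)
    lift (inj₁ _) = 0# ∷ c′
    lift (inj₂ t) = 1# ∷ t · c′

    lift-nonzero : ¬ c′ ≡ zeroV → ∀ c → ¬ lift c ≡ zeroV
    lift-nonzero c′≢0 (inj₁ _) e = c′≢0 (∷-injectiveʳ e)
    lift-nonzero c′≢0 (inj₂ _) e = 1≢0 (∷-injectiveˡ e)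

    killed : Vect (suc d) → ⊤ ⊎ Carrier
    killed (a ∷ w) with dot w c′ ≟F 0#
    ... | yes _ = inj₁ tt
    ... | no _  = inj₂ (-F (a *F dot w c′ ⁻¹))

    lift-survives : (g : Vect (suc d)) → ¬ g ≡ zeroV → (¬ tail g ≡ zeroV → ¬ dot (tail g) c′ ≡ 0#) →
                    ∀ c → ¬ killed g ≡ c → ¬ dot g (lift c) ≡ 0#
    lift-survives (a ∷ w) g≢0 w-avoids c not-killed with dot w c′ ≟F 0#
    lift-survives (a ∷ w) g≢0 w-avoids (inj₁ _) not-killed | yes _ = contradiction refl not-killed
    lift-survives (a ∷ w) g≢0 w-avoids (inj₂ t) not-killed | yes s≡0 = a≢0 ∘ trans (sym value)
      where
      value : dot (a ∷ w) (1# ∷ t · c′) ≡ a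
      value = trans (cong₂ _+F_ (*-identityʳ a) (trans (dot-·ʳ t w c′) (trans (cong (t *F_) s≡0) (zeroʳ t))))
                    (+-identityʳ a)
      a≢0 : ¬ a ≡ 0#
      a≢0 refl = w-avoids (λ w≡0 → g≢0 (cong (0# ∷_) w≡0)) s≡0
    lift-survives (a ∷ w) g≢0 w-avoids (inj₁ _) not-killed | no s≢0 =
      s≢0 ∘ trans (sym (trans (cong (_+F dot w c′) (zeroʳ a)) (+-identityˡ _)))
    lift-survives (a ∷ w) g≢0 w-avoids (inj₂ t) not-killed | no s≢0 =
      λ dot≡0 → not-killed (cong inj₂ (sym (t≡ dot≡0)))
      where
      s : Carrier
      s = dot w c′
      t≡ : a *F 1# +F dot w (t · c′) ≡ 0# → t ≡ -F (a *F s ⁻¹)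
      t≡ dot≡0 = begin
        t                   ≡⟨ sym (*-identityʳ t) ⟩
        t *F 1#             ≡⟨ cong (t *F_) (sym (⁻¹-inverseʳ s s≢0)) ⟩
        t *F (s *F s ⁻¹)    ≡⟨ sym (*-assoc t s (s ⁻¹)) ⟩
        (t *F s) *F s ⁻¹    ≡⟨ cong (_*F s ⁻¹) ts≡-a ⟩
        -F a *F s ⁻¹        ≡⟨ sym (-‿distribˡ-* a (s ⁻¹)) ⟩
        -F (a *F s ⁻¹)      ∎
        where
        open ≡-Reasoning
        ts≡-a : t *F s ≡ -F a
        ts≡-a = +-inverseʳ-unique a (t *F s) (trans (cong₂ _+F_ (sym (*-identityʳ a)) (sym (dot-·ʳ t w c′))) dot≡0)

  avoid-hyperplanes : ∀ d {N} {P : Pred (Fin N) ℓ} (P? : Decidable P) (f : Fin N → Vect (suc d)) →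
    (∀ i → P i → ¬ f i ≡ zeroV) → count P? ≤ q → ∃ λ c → ¬ c ≡ zeroV × ∀ i → P i → ¬ dot (f i) c ≡ 0#
  avoid-hyperplanes zero P? f nonzero _ =
    unit zero , (λ e → 1≢0 (∷-injectiveˡ e)) , λ i Pi → unit-survives (f i) (nonzero i Pi)
    where
    unit-survives : (g : Vect 1) → ¬ g ≡ zeroV → ¬ dot g (unit zero) ≡ 0#
    unit-survives (a ∷ []) g≢0 dot≡0 = g≢0 (cong (_∷ []) (trans (sym (dot-unitʳ (a ∷ []) zero)) dot≡0))
  avoid-hyperplanes (suc d) {P = P} P? f nonzero few =
    lift c , lift-nonzero c′≢0 c ,
    λ i Pi → lift-survives (f i) (nonzero i Pi) (λ t≢0 → c′-avoids i (Pi , t≢0)) c (missed i Pi)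
    where
    T? : Decidable (λ i → ¬ tail (f i) ≡ zeroV)
    T? i = ¬? (tail (f i) ≟V zeroV)

    c′-spec : ∃ λ c′ → ¬ c′ ≡ zeroV × ∀ i → P i × ¬ tail (f i) ≡ zeroV → ¬ dot (tail (f i)) c′ ≡ 0#
    c′-spec = avoid-hyperplanes d (P? ∩? T?) (tail ∘ f) (λ _ → proj₂)
                                (ℕₚ.≤-trans (count-mono (P? ∩? T?) P? (λ _ → proj₁)) few)

    c′ : Vect (suc d)
    c′ = proj₁ c′-spec

    c′≢0 : ¬ c′ ≡ zeroV
    c′≢0 = proj₁ (proj₂ c′-spec)

    c′-avoids : ∀ i → P i × ¬ tail (f i) ≡ zeroV → ¬ dot (tail (f i)) c′ ≡ 0#
    c′-avoids = proj₂ (proj₂ c′-spec)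

    open Lifts c′

    c-missed : ∃ λ c → ∀ i → P i → ¬ killed (f i) ≡ c
    c-missed = pigeonhole-miss (⊎ₚ.≡-dec ⊤ₚ._≟_ _≟F_) ⊤⊎Carrier↔Fin P? (killed ∘ f) (s≤s few)

    c : ⊤ ⊎ Carrier
    c = proj₁ c-missed

    missed : ∀ i → P i → ¬ killed (f i) ≡ c
    missed = proj₂ c-missed

  zeroV-++ : ∀ a b → zeroV {a + b} ≡ zeroV {a} ++ zeroV {b}
  zeroV-++ zero    b = refl
  zeroV-++ (suc a) b = cong (0# ∷_) (zeroV-++ a b)

  ++≡zeroV : ∀ {a b} (u : Vect a) (v : Vect b) → u ++ v ≡ zeroV → u ≡ zeroV × v ≡ zeroV
  ++≡zeroV {a} {b} u v eq = ++-injective u zeroV (trans eq (zeroV-++ a b))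

  γ·c≡0⇒γ≡0 : ∀ γ (c : Vect d) → ¬ c ≡ zeroV → γ · c ≡ zeroV → γ ≡ 0#
  γ·c≡0⇒γ≡0 γ c c≢0 γ·c≡0 with γ ≟F 0#
  ... | yes γ≡0 = γ≡0
  ... | no γ≢0  = contradiction (trans (c·u≡w⇒u≡c⁻¹·w γ c zeroV γ≢0 γ·c≡0) (·-zeroʳ (γ ⁻¹))) c≢0

  nonzero-entry : {v : Vect d} → ¬ v ≡ zeroV → ∃ λ j → ¬ lookup v j ≡ 0#
  nonzero-entry {d} {v} v≢0 = Finₚ.¬∀⟶∃¬ d _ (λ j → lookup v j ≟F 0#)
    λ v≗0 → v≢0 (≗⇒≡ λ j → trans (v≗0 j) (sym (lookup-replicate j 0#)))

  lookup-lincomb′ : (i : Fin n) (cs : Vect d) (vs : Vec (Vect n) d) → lookup (lincomb cs vs) i ≡ dot (col i vs) cs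
  lookup-lincomb′ i cs vs = trans (lookup-lincomb i cs vs) (dot-comm cs (col i vs))

  spans⇒⊆Coord : (S : Subspace n) (T : Vec (Vect n) d) → (∀ x → x ∈ S → InSpan T x) →
                  ∀ i → col i T ≡ zeroV → S ⊆ Coord i
  spans⇒⊆Coord S T spans i col≡0 x x∈S with spans x x∈S
  ... | cs , refl = trans (lookup-lincomb i cs T) (trans (cong (dot cs) col≡0) (dot-zeroʳ cs))

  col-nonzero : ∀ {a m} (S : Subspace n) (V : Vec (Vect n) a) (B : Vec (Vect n) m) → IsBasis S (V ++ B) →
                (∀ i → ¬ S ⊆ Coord i) → ∀ i → col i B ≡ zeroV → ¬ col i V ≡ zeroV
  col-nonzero {a = a} {m} S V B (_ , _ , spans) nondegenerate i Bi≡0 Vi≡0 = nondegenerate i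
    (spans⇒⊆Coord S (V ++ B) spans i (trans (map-++ _ V B) (trans (cong₂ _++_ Vi≡0 Bi≡0) (sym (zeroV-++ a m)))))

  complement-basis : ∀ {k m} (S : Subspace n) → HasDim S k → {B : Vec (Vect n) m} →
                     (∀ i → lookup B i ∈ S) → Independent B → Σ (Vec (Vect n) (k ∸ m)) λ U → IsBasis S (U ++ B)
  complement-basis {n = n} {k = k} {m = m} S (bs , bs-basis) {B} B∈S independent with extend-basis S bs-basis B∈S independent
  ... | L , U , UB-basis = subst (λ L → Σ (Vec (Vect n) L) λ U → IsBasis S (U ++ B)) L≡ (U , UB-basis)
    where
    L≡ : L ≡ k ∸ m
    L≡ = trans (sym (ℕₚ.m+n∸n≡m L m)) (cong (_∸ m) (dim-unique S (U ++ B , UB-basis) (bs , bs-basis)))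

  module Neighbour {n m d} (X Y : Subspace n) (B : Vec (Vect n) m) (U W : Vec (Vect n) (suc d))
    (B-basis : IsBasis (X ∩ Y) B) (UB-basis : IsBasis X (U ++ B)) (WB-basis : IsBasis Y (W ++ B))
    (X-nondegenerate : ∀ i → ¬ X ⊆ Coord i) (Y-nondegenerate : ∀ i → ¬ Y ⊆ Coord i)
    (bound : n < [ suc d ] q * (q + 1) + m) where

    T : Vec (Vect n) (suc d + (suc d + m))
    T = U ++ (W ++ B)

    lincomb-T : ∀ μ ω β → lincomb (μ ++ (ω ++ β)) T ≡ lincomb μ U ⊕ (lincomb ω W ⊕ lincomb β B)
    lincomb-T μ ω β = trans (lincomb-++ μ (ω ++ β) U (W ++ B)) (cong (lincomb μ U ⊕_) (lincomb-++ ω β W B))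

    lincomb-UB : (μ : Vect (suc d)) (β : Vect m) → lincomb (μ ++ β) (U ++ B) ≡ lincomb (μ ++ (zeroV {suc d} ++ β)) T
    lincomb-UB μ β = trans (lincomb-++ μ β U B)
      (sym (trans (lincomb-++ μ (zeroV ++ β) U (W ++ B)) (cong (lincomb μ U ⊕_) (lincomb-zeroV++ β W B))))

    lincomb-WB : (ω : Vect (suc d)) (β : Vect m) → lincomb (ω ++ β) (W ++ B) ≡ lincomb (zeroV {suc d} ++ (ω ++ β)) T
    lincomb-WB ω β = sym (lincomb-zeroV++ (ω ++ β) U (W ++ B))

    in-X : ∀ μ β → lincomb μ U ⊕ lincomb β B ∈ X
    in-X μ β = subst (_∈ X) (lincomb-++ μ β U B) (lincomb-∈ X (proj₁ UB-basis) (μ ++ β))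

    in-Y : ∀ ω β → lincomb ω W ⊕ lincomb β B ∈ Y
    in-Y ω β = subst (_∈ Y) (lincomb-++ ω β W B) (lincomb-∈ Y (proj₁ WB-basis) (ω ++ β))

    -- u + w + b = 0 puts w in X ∩ Y = span B, so w = 0 by independence of W ++ B.
    lincomb-T≡zeroV : ∀ μ ω β → lincomb μ U ⊕ (lincomb ω W ⊕ lincomb β B) ≡ zeroV →
                      μ ≡ zeroV × ω ≡ zeroV × β ≡ zeroV
    lincomb-T≡zeroV μ ω β eq = proj₁ μβ≡0 , ω≡0 , proj₂ μβ≡0
      where
      u w b : Vect n
      u = lincomb μ U
      w = lincomb ω W
      b = lincomb β B
      w≡⊖ : w ≡ ⊖ (u ⊕ b)
      w≡⊖ = ⊕ₚ.inverseˡ-unique w (u ⊕ b) (trans (⊕ₛ.x∙yz≈y∙xz w u b) eq)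
      w∈X : w ∈ X
      w∈X = subst (_∈ X) (trans (sym (⊖≗-1· (u ⊕ b))) (sym w≡⊖)) (·∈ X (-F 1#) (in-X μ β))
      w∈Y : w ∈ Y
      w∈Y = subst (_∈ Y) (trans (cong (w ⊕_) (lincomb-zeroˡ B)) (⊕.identityʳ w)) (in-Y ω zeroV)
      β′ : Vect m
      β′ = proj₁ (proj₂ (proj₂ B-basis) w (w∈X , w∈Y))
      w≡ : w ≡ lincomb β′ B
      w≡ = proj₂ (proj₂ (proj₂ B-basis) w (w∈X , w∈Y))
      ω≡0 : ω ≡ zeroV
      ω≡0 = proj₁ (++≡zeroV ω (⊖ β′) (proj₁ (proj₂ WB-basis) (ω ++ ⊖ β′) (begin
        lincomb (ω ++ ⊖ β′) (W ++ B)   ≡⟨ lincomb-++ ω (⊖ β′) W B ⟩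
        w ⊕ lincomb (⊖ β′) B           ≡⟨ cong (w ⊕_) (trans (lincomb-⊖ β′ B) (cong ⊖_ (sym w≡))) ⟩
        w ⊕ ⊖ w                        ≡⟨ ⊕.inverseʳ w ⟩
        zeroV                          ∎)))
        where open ≡-Reasoning
      μβ≡0 : μ ≡ zeroV × β ≡ zeroV
      μβ≡0 = ++≡zeroV μ β (proj₁ (proj₂ UB-basis) (μ ++ β) (begin
        lincomb (μ ++ β) (U ++ B)   ≡⟨ lincomb-++ μ β U B ⟩
        u ⊕ b                       ≡⟨ cong (u ⊕_) (sym (⊕.identityˡ b)) ⟩
        u ⊕ (zeroV ⊕ b)             ≡⟨ cong (λ v → u ⊕ (v ⊕ b)) (sym (trans (cong (λ ω → lincomb ω W) ω≡0)
                                                                                (lincomb-zeroˡ W))) ⟩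
        u ⊕ (w ⊕ b)                 ≡⟨ eq ⟩
        zeroV                       ∎))
        where open ≡-Reasoning

    T-independent : Independent T
    T-independent cs eq with splitAt (suc d) cs
    ... | μ , ωβ , refl with splitAt (suc d) ωβ
    ...   | ω , β , refl with lincomb-T≡zeroV μ ω β (trans (sym (lincomb-T μ ω β)) eq)
    ...     | refl , refl , refl = sym (trans (zeroV-++ (suc d) (suc d + m)) (cong (zeroV {suc d} ++_) (zeroV-++ (suc d) m)))

    K? : Decidable (λ i → col i B ≡ zeroV)
    K? i = col i B ≟V zeroV

    lookup-B≡0 : ∀ β i → col i B ≡ zeroV → lookup (lincomb β B) i ≡ 0#
    lookup-B≡0 β i Bi≡0 = trans (lookup-lincomb i β B) (trans (cong (dot β) Bi≡0) (dot-zeroʳ β))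

    m≤count∁K : m ≤ count (∁? K?)
    m≤count∁K = injective⇒≤ (λ β → select (∁? K?) (lincomb β B)) λ β β′ eq →
      lincomb-injective (proj₁ (proj₂ B-basis)) β β′ (select-injective (∁? K?) _ _
        (λ i ¬¬Ki → let Ki = decidable-stable (K? i) ¬¬Ki in trans (lookup-B≡0 β i Ki) (sym (lookup-B≡0 β′ i Ki))) eq)

    few-K : count K? < suc q * [ suc d ] q
    few-K = ℕₚ.+-cancelʳ-< m (count K?) (suc q * [ suc d ] q) (begin-strict
      count K? + m                 ≤⟨ ℕₚ.+-monoʳ-≤ (count K?) m≤count∁K ⟩
      count K? + count (∁? K?)     ≡⟨ count-complement K? ⟩
      n                            <⟨ bound ⟩
      [ suc d ] q * (q + 1) + m    ≡⟨ cong (_+ m) (trans (ℕₚ.*-comm ([ suc d ] q) (q + 1))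
                                                         (cong (_* [ suc d ] q) (ℕₚ.+-comm q 1))) ⟩
      suc q * [ suc d ] q + m      ∎)
      where open ℕₚ.≤-Reasoning

    module Construction (p : Point (suc d)) (c : Vect (suc d)) (c≢0 : ¬ c ≡ zeroV)
      (c-avoids : ∀ i → col i B ≡ zeroV × col i U ∈⟨ p ⟩ → ¬ dot (col i W) c ≡ 0#) where

      H : Vec (Vect n) d
      H = map (λ k → lincomb k U) (hyperplane p)

      y : Vect n
      y = lincomb c W

      Zb : Vec (Vect n) (d + suc m)
      Zb = H ++ (y ∷ B)

      Z : Subspace n
      Z = span Zb

      lincomb-Zb : ∀ α γ β → lincomb (α ++ (γ ∷ β)) Zb ≡ lincomb (lincomb α (hyperplane p) ++ (γ · c ++ β)) T
      lincomb-Zb α γ β = begin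
        lincomb (α ++ (γ ∷ β)) Zb
          ≡⟨ lincomb-++ α (γ ∷ β) H (y ∷ B) ⟩
        lincomb α H ⊕ (γ · y ⊕ lincomb β B)
          ≡⟨ cong₂ (λ u w → u ⊕ (w ⊕ lincomb β B)) (lincomb-lincomb α (hyperplane p) U) (sym (lincomb-· γ c W)) ⟩
        lincomb (lincomb α (hyperplane p)) U ⊕ (lincomb (γ · c) W ⊕ lincomb β B)
          ≡⟨ sym (lincomb-T (lincomb α (hyperplane p)) (γ · c) β) ⟩
        lincomb (lincomb α (hyperplane p) ++ (γ · c ++ β)) T
          ∎
        where open ≡-Reasoning

      split-Zb : (cs : Vect (d + suc m)) → ∃ λ α → ∃ λ γ → ∃ λ β → cs ≡ α ++ (γ ∷ β)
      split-Zb cs with splitAt d cs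
      ... | α , γ ∷ β , cs≡ = α , γ , β , cs≡

      T-coefficients : ∀ α γ β μ ω β′ → lincomb (α ++ (γ ∷ β)) Zb ≡ lincomb (μ ++ (ω ++ β′)) T →
                       lincomb α (hyperplane p) ≡ μ × γ · c ≡ ω × β ≡ β′
      T-coefficients α γ β μ ω β′ eq = proj₁ α≡×rest , ++-injective (γ · c) ω (proj₂ α≡×rest)
        where
        coefficients≡ : lincomb α (hyperplane p) ++ (γ · c ++ β) ≡ μ ++ (ω ++ β′)
        coefficients≡ = lincomb-injective T-independent _ _ (trans (sym (lincomb-Zb α γ β)) eq)
        α≡×rest : lincomb α (hyperplane p) ≡ μ × γ · c ++ β ≡ ω ++ β′
        α≡×rest = ++-injective (lincomb α (hyperplane p)) μ coefficients≡

      Zb-independent : Independent Zb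
      Zb-independent cs eq with split-Zb cs
      ... | α , γ , β , refl = begin
        α ++ (γ ∷ β)                 ≡⟨ cong₂ _++_ α≡0 (cong₂ _∷_ γ≡0 (proj₂ γc,β≡0)) ⟩
        zeroV {d} ++ zeroV {suc m}   ≡⟨ sym (zeroV-++ d (suc m)) ⟩
        zeroV                        ∎
        where
        open ≡-Reasoning
        coefficients≡0 : lincomb α (hyperplane p) ++ (γ · c ++ β) ≡ zeroV
        coefficients≡0 = T-independent _ (trans (sym (lincomb-Zb α γ β)) eq)
        γc,β≡0 : γ · c ≡ zeroV × β ≡ zeroV
        γc,β≡0 = ++≡zeroV (γ · c) β (proj₂ (++≡zeroV (lincomb α (hyperplane p)) _ coefficients≡0))
        α≡0 : α ≡ zeroV
        α≡0 = hyperplane-independent p α (proj₁ (++≡zeroV (lincomb α (hyperplane p)) _ coefficients≡0))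
        γ≡0 : γ ≡ 0#
        γ≡0 = γ·c≡0⇒γ≡0 γ c c≢0 (proj₁ γc,β≡0)

      Z-dim : HasDim Z (suc d + m)
      Z-dim = subst (HasDim Z) (ℕₚ.+-suc d m) (Zb , span-isBasis Zb-independent)

      lincomb-HB : ∀ α β → lincomb (α ++ β) (H ++ B) ≡ lincomb (α ++ (0# ∷ β)) Zb
      lincomb-HB α β = trans (lincomb-++ α β H B) (sym (trans (lincomb-++ α (0# ∷ β) H (y ∷ B))
        (cong (lincomb α H ⊕_) (trans (cong (_⊕ lincomb β B) (·-zeroˡ y)) (⊕.identityˡ _)))))

      lincomb-yB : ∀ γ β → lincomb (γ ∷ β) (y ∷ B) ≡ lincomb (zeroV {d} ++ (γ ∷ β)) Zb
      lincomb-yB γ β = sym (lincomb-zeroV++ (γ ∷ β) H (y ∷ B))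

      H∈Z : ∀ α → lincomb α H ∈ Z
      H∈Z α = α ++ zeroV , sym (trans (sym (lincomb-HB α zeroV)) (lincomb-++zeroV α H B))

      B∈Z : ∀ β → lincomb β B ∈ Z
      B∈Z β = zeroV ++ (0# ∷ β) , sym (trans (sym (lincomb-HB zeroV β)) (lincomb-zeroV++ β H B))

      y∈Z : y ∈ Z
      y∈Z = zeroV ++ (1# ∷ zeroV) ,
            sym (trans (sym (lincomb-yB 1# zeroV)) (trans (cong₂ _⊕_ (·-identityˡ y) (lincomb-zeroˡ B)) (⊕.identityʳ y)))

      Z∩X-basis : IsBasis (Z ∩ X) (H ++ B)
      Z∩X-basis = (λ i → subst (_∈ Z ∩ X) (lincomb-unit i (H ++ B)) (member (unit i))) , independent , spanned
        where
        member : ∀ cs → lincomb cs (H ++ B) ∈ Z ∩ X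
        member cs with splitAt d cs
        ... | α , β , refl = (α ++ (0# ∷ β) , lincomb-HB α β) ,
          subst (_∈ X) (sym (trans (lincomb-++ α β H B) (cong (_⊕ lincomb β B) (lincomb-lincomb α (hyperplane p) U))))
                (in-X (lincomb α (hyperplane p)) β)
        independent : Independent (H ++ B)
        independent cs eq with splitAt d cs
        ... | α , β , refl =
          let α≡0 , 0∷β≡0 = ++≡zeroV α (0# ∷ β) (Zb-independent _ (trans (sym (lincomb-HB α β)) eq))
          in trans (cong₂ _++_ α≡0 (∷-injectiveʳ 0∷β≡0)) (sym (zeroV-++ d m))
        spanned : ∀ x → x ∈ Z ∩ X → InSpan (H ++ B) x
        spanned x ((cs , x≡) , x∈X) with split-Zb cs | proj₂ (proj₂ UB-basis) x x∈X
        ... | α , γ , β , refl | cs′ , x≡′ with splitAt (suc d) cs′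
        ...   | μ , β′ , refl =
          let γc≡0 = proj₁ (proj₂ (T-coefficients α γ β μ zeroV β′
                                    (trans (sym x≡) (trans x≡′ (lincomb-UB μ β′)))))
          in α ++ β , trans x≡ (trans (cong (λ γ → lincomb (α ++ (γ ∷ β)) Zb) (γ·c≡0⇒γ≡0 γ c c≢0 γc≡0))
                                      (sym (lincomb-HB α β)))

      Z∩Y-basis : IsBasis (Z ∩ Y) (y ∷ B)
      Z∩Y-basis = (λ i → subst (_∈ Z ∩ Y) (lincomb-unit i (y ∷ B)) (member (unit i))) , independent , spanned
        where
        member : ∀ cs → lincomb cs (y ∷ B) ∈ Z ∩ Y
        member (γ ∷ β) = (zeroV ++ (γ ∷ β) , lincomb-yB γ β) ,
          subst (_∈ Y) (cong (_⊕ lincomb β B) (lincomb-· γ c W)) (in-Y (γ · c) β)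
        independent : Independent (y ∷ B)
        independent (γ ∷ β) eq =
          proj₂ (++≡zeroV (zeroV {d}) (γ ∷ β) (Zb-independent _ (trans (sym (lincomb-yB γ β)) eq)))
        spanned : ∀ x → x ∈ Z ∩ Y → InSpan (y ∷ B) x
        spanned x ((cs , x≡) , x∈Y) with split-Zb cs | proj₂ (proj₂ WB-basis) x x∈Y
        ... | α , γ , β , refl | cs′ , x≡′ with splitAt (suc d) cs′
        ...   | ω , β′ , refl =
          let α′≡0 = proj₁ (T-coefficients α γ β zeroV ω β′ (trans (sym x≡) (trans x≡′ (lincomb-WB ω β′))))
          in γ ∷ β , trans x≡ (trans (cong (λ α → lincomb (α ++ (γ ∷ β)) Zb) (hyperplane-independent p α α′≡0))
                                     (sym (lincomb-yB γ β)))

      Z-nondegenerate : ∀ i → ¬ Z ⊆ Coord i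
      Z-nondegenerate i Z⊆Cᵢ with K? i
      ... | no Bᵢ≢0 =
        let j , Bᵢⱼ≢0 = nonzero-entry Bᵢ≢0
        in Bᵢⱼ≢0 (trans (sym (trans (lookup-lincomb′ i (unit j) B) (dot-unitʳ (col i B) j))) (Z⊆Cᵢ _ (B∈Z (unit j))))
      ... | yes Bᵢ≡0 with col i U ∈⟨ p ⟩?
      ...   | yes Uᵢ∈ = c-avoids i (Bᵢ≡0 , Uᵢ∈) (trans (sym (lookup-lincomb′ i c W)) (Z⊆Cᵢ y y∈Z))
      ...   | no Uᵢ∉ =
        let j , dot≢0 = Finₚ.¬∀⟶∃¬ d _ (λ j → dot (col i U) (lookup (hyperplane p) j) ≟F 0#) Uᵢ∉
        in dot≢0 (trans (sym (trans (cong (λ v → lookup v i) (trans (lincomb-lincomb (unit j) (hyperplane p) U)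
                                                                      (cong (λ k → lincomb k U) (lincomb-unit j (hyperplane p)))))
                                    (lookup-lincomb′ i (lookup (hyperplane p) j) U)))
                        (Z⊆Cᵢ _ (H∈Z (unit j))))

      result : ∃ λ Z → IsCode n (suc d + m) Z × Adjacent (suc d + m) Z X × Distance (suc d + m) Z Y d
      result = Z , (Z-dim , Z-nondegenerate) , (H ++ B , Z∩X-basis) , suc m , (y ∷ B , Z∩Y-basis) , sym (ℕₚ.m+n∸n≡m d m)

    p-spec : ∃ λ p → count (K? ∩? λ i → col i U ∈⟨ p ⟩?) ≤ q
    p-spec = few-on-some-point d K? (λ i → col i U) (col-nonzero X U B UB-basis X-nondegenerate) few-K

    c-spec : ∃ λ c → ¬ c ≡ zeroV ×
               ∀ i → col i B ≡ zeroV × col i U ∈⟨ proj₁ p-spec ⟩ → ¬ dot (col i W) c ≡ 0#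
    c-spec = avoid-hyperplanes d (K? ∩? λ i → col i U ∈⟨ proj₁ p-spec ⟩?) (λ i → col i W)
               (λ i (Bᵢ≡0 , _) → col-nonzero Y W B WB-basis Y-nondegenerate i Bᵢ≡0) (proj₂ p-spec)

    neighbour : ∃ λ Z → IsCode n (suc d + m) Z × Adjacent (suc d + m) Z X × Distance (suc d + m) Z Y d
    neighbour = Construction.result (proj₁ p-spec) (proj₁ c-spec) (proj₁ (proj₂ c-spec)) (proj₂ (proj₂ c-spec))

lemma2 : (F : FiniteField) → let open LinearAlgebra F in
    (n k : ℕ) → 1 < k → k < n ∸ 1 →
    (X Y : Subspace n) → IsCode n k X → IsCode n k Y →
    ¬ Adjacent k X Y →
    (m : ℕ) → HasDim (X ∩ Y) m →
    n < ([ k ∸ m ] FiniteField.size F) * (FiniteField.size F + 1) + m →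
    ∃ λ (Z : Subspace n) → IsCode n k Z × Adjacent k Z X × Distance k Z Y ((k ∸ m) ∸ 1)
lemma2 F n k _ k<n∸1 X Y (X-dim , X-nondegenerate) (Y-dim , Y-nondegenerate) _ m (B , B-basis) bound
  with k ∸ m | complement-basis F X X-dim (proj₁ ∘ proj₁ B-basis) (proj₁ (proj₂ B-basis))
             | complement-basis F Y Y-dim (proj₂ ∘ proj₁ B-basis) (proj₁ (proj₂ B-basis))
... | zero  | [] , B-basis-X | _ =
  contradiction (subst (n <_) (dim-unique F X (B , B-basis-X) X-dim) bound)
                (ℕₚ.<-asym (ℕₚ.<-≤-trans k<n∸1 (ℕₚ.m∸n≤m n 1)))
... | suc d | U , UB-basis | W , WB-basis =
  subst (λ k → ∃ λ Z → IsCode n k Z × Adjacent k Z X × Distance k Z Y d) (dim-unique F X (U ++ B , UB-basis) X-dim)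
        (Neighbour.neighbour F X Y B U W B-basis UB-basis WB-basis X-nondegenerate Y-nondegenerate bound)
  where open LinearAlgebra F
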